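{- For any state predicates $U,V,I$ and setoid trace predicates $P,Q,R$: (1) $\langle U\rangle\ast\ast\mathrm{dup}(V)\Leftrightarrow\mathrm{dup}(U\wedge V)\Leftrightarrow\mathrm{dup}(U)\ast\ast\langle V\rangle$; (2) $\langle U\rangle\ast\ast\langle V\rangle\Leftrightarrow\langle U\wedge V\rangle$; (3) $\langle\mathsf{true}\rangle\ast\ast P\Leftrightarrow P\Leftrightarrow P\ast\ast\langle\mathsf{true}\rangle$; (4) $(P\ast\ast Q)\ast\ast R\Leftrightarrow P\ast\ast(Q\ast\ast R)$; (5) $P^{\dagger}\Leftrightarrow\langle\mathsf{true}\rangle\vee(P\ast\ast P^{\dagger})$; (6) $P^{\dagger}\Leftrightarrow P^{\dagger}\ast\ast P^{\dagger}$; (7) $\mathit{infinite}\Leftrightarrow\mathsf{true}\ast\ast\langle\mathsf{false}\rangle$; (8) if $P\models\mathit{infinite}$ then $\mathrm{Last}(P)\Leftrightarrow\mathsf{false}$; (9) $P\Leftrightarrow P\ast\ast\langle\mathrm{Last}(P)\rangle$; (10) $\mathrm{Last}(\langle U\rangle)\Leftrightarrow U$; (11) $\mathrm{Last}(P\ast\ast Q)\models\mathrm{Last}(Q)$; (12) $\mathrm{Last}(\langle\mathrm{Last}(P)\rangle\ast\ast Q)\Leftrightarrow\mathrm{Last}(P\ast\ast Q)$; (13) $\mathrm{Last}(P\ast\ast\langle U\rangle)\models U$; (14) $\mathrm{Last}(\langle I\rangle\ast\ast(P\ast\ast\mathrm{dup}(I))^{\dagger})\models I$.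
   Context: The metatheory is constructive. States $\sigma$ assign integers to variables. Traces are coinductive: $\langle\sigma\rangle$ is a trace, and $\sigma::\tau$ is a trace if $\tau$ is. Bisimilarity $\approx$: coinductively $\langle\sigma\rangle\approx\langle\sigma\rangle$, $\sigma::\tau\approx\sigma::\tau'$ if $\tau\approx\tau'$. $\mathit{hd}\langle\sigma\rangle=\mathit{hd}(\sigma::\tau)=\sigma$. $\tau\downarrow\sigma$ is inductive: $\langle\sigma\rangle\downarrow\sigma$; $\sigma::\tau\downarrow\sigma'$ if $\tau\downarrow\sigma'$. Infiniteness is coinductive: $\sigma::\tau$ is infinite if $\tau$ is. A setoid trace predicate is invariant under $\approx$. State predicates are arbitrary predicates on states; $\mathsf{true},\mathsf{false},\wedge,\vee$ act pointwise on state and on trace predicates. $P\models Q$: every trace satisfying $P$ satisfies $Q$ (similarly for state predicates); $\Leftrightarrow$ means entailment in both directions. Connectives: $\langle U\rangle$ holds exactly of $\langle\sigma\rangle$ with $\sigma$ satisfying $U$; $\mathrm{dup}(U)$ holds exactly of $\sigma::\langle\sigma\rangle$ with $\sigma$ satisfying $U$. $\mathrm{follows}_Q(\tau,\tau')$ is coinductive: $\mathrm{follows}_Q(\langle\sigma\rangle,\tau)$ if $\mathit{hd}\,\tau=\sigma$ and $\tau$ satisfies $Q$; $\mathrm{follows}_Q(\sigma::\tau,\sigma::\tau')$ if $\mathrm{follows}_Q(\tau,\tau')$. $\tau'$ satisfies $P\ast\ast Q$ iff some $\tau$ satisfies $P$ and $\mathrm{follows}_Q(\tau,\tau')$. $P^{\dagger}$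 is coinductive: $\tau$ satisfies $P^{\dagger}$ if $\tau$ satisfies $\langle\mathsf{true}\rangle$; $\tau'$ satisfies $P^{\dagger}$ if some $\tau$ satisfies $P$ and $\mathrm{follows}_{P^{\dagger}}(\tau,\tau')$. $\mathrm{Last}(P)$ holds of $\sigma$ iff some $\tau$ satisfies $P$ and $\tau\downarrow\sigma$. $\mathit{infinite}$ is the trace predicate "is infinite". Unparenthesized chains of $\ast\ast$ associate to the right. -}

module Defs where

open import Level using (Level; _⊔_; 0ℓ; Lift; lift) renaming (suc to lsuc)
open import Data.Nat using (ℕ; zero; suc)
open import Data.Integer using (ℤ)
open import Data.Bool using (Bool; true; false)
open import Data.Product using (Σ; _×_; _,_; proj₁; proj₂; Σ-syntax)
open import Data.Sum using (_⊎_; inj₁; inj₂)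
open import Data.Unit.Polymorphic using (⊤)
open import Data.Empty.Polymorphic using (⊥)
open import Relation.Binary.PropositionalEquality using (_≡_)

private
  variable
    a b ℓ : Level

Var : Set
Var = ℕ

State : Set
State = Var → ℤ

Trace : Set
Trace = ℕ → State × Bool

data Shape : Set where
  nil  : State → Shape
  cons : State → Trace → Shape

out : Trace → Shape
out t with t 0
... | σ , true  = nil σ
... | σ , false = cons σ (λ n → t (suc n))

⟨_⟩ᵗ : State → Trace
⟨ σ ⟩ᵗ _ = σ , true

_::_ : State → Trace → Trace
(σ :: τ) zero    = σ , false
(σ :: τ) (suc n) = τ n

hdSh : Shape → State
hdSh (nil σ)    = σ
hdSh (cons σ _) = σ

hd : Trace → State
hd τ = hdSh (out τ)

-- Greatest fixed points (coinductive definitions)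

ν : {A : Set a} (ℓ : Level) → ((A → Set ℓ) → A → Set b) → A → Set (a ⊔ lsuc ℓ ⊔ b)
ν {A = A} ℓ F x = Σ[ R ∈ (A → Set ℓ) ] ((∀ y → R y → F R y) × R x)

≈Sh : (Trace × Trace → Set) → Shape → Shape → Set
≈Sh R (nil σ)     (nil σ')     = σ ≡ σ'
≈Sh R (cons σ τ)  (cons σ' τ') = σ ≡ σ' × R (τ , τ')
≈Sh R _           _            = ⊥

≈F : (Trace × Trace → Set) → Trace × Trace → Set
≈F R (τ , τ') = ≈Sh R (out τ) (out τ')

infix 4 _≈_
_≈_ : Trace → Trace → Set₁
τ ≈ τ' = ν 0ℓ ≈F (τ , τ')

infix 4 _↓_ _↓Sh_
data _↓Sh_ : Shape → State → Set

_↓_ : Trace → State → Set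
τ ↓ σ = out τ ↓Sh σ

data _↓Sh_ where
  nil↓  : ∀ {σ} → nil σ ↓Sh σ
  cons↓ : ∀ {σ τ σ'} → τ ↓ σ' → cons σ τ ↓Sh σ'

infSh : (Trace → Set) → Shape → Set
infSh R (nil _)    = ⊥
infSh R (cons _ τ) = R τ

infF : (Trace → Set) → Trace → Set
infF R τ = infSh R (out τ)

infinite : Trace → Set₁
infinite = ν 0ℓ infF

SPred : (ℓ : Level) → Set (lsuc ℓ)
SPred ℓ = State → Set ℓ

TPred : (ℓ : Level) → Set (lsuc ℓ)
TPred ℓ = Trace → Set ℓ

trueₛ falseₛ : SPred 0ℓ
trueₛ _  = ⊤
falseₛ _ = ⊥

trueₜ falseₜ : TPred 0ℓ
trueₜ _  = ⊤
falseₜ _ = ⊥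

infixr 6 _∧ₛ_ _∧ₜ_
infixr 5 _∨ₛ_ _∨ₜ_
_∧ₛ_ : SPred a → SPred b → SPred (a ⊔ b)
(U ∧ₛ V) σ = U σ × V σ
_∨ₛ_ : SPred a → SPred b → SPred (a ⊔ b)
(U ∨ₛ V) σ = U σ ⊎ V σ
_∧ₜ_ : TPred a → TPred b → TPred (a ⊔ b)
(P ∧ₜ Q) τ = P τ × Q τ
_∨ₜ_ : TPred a → TPred b → TPred (a ⊔ b)
(P ∨ₜ Q) τ = P τ ⊎ Q τ

infix 2 _⊨_ _⊨ₛ_ _⇔_ _⇔ₛ_
_⊨_ : TPred a → TPred b → Set (a ⊔ b)
P ⊨ Q = ∀ τ → P τ → Q τ
_⊨ₛ_ : SPred a → SPred b → Set (a ⊔ b)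
U ⊨ₛ V = ∀ σ → U σ → V σ
_⇔_ : TPred a → TPred b → Set (a ⊔ b)
P ⇔ Q = (P ⊨ Q) × (Q ⊨ P)
_⇔ₛ_ : SPred a → SPred b → Set (a ⊔ b)
U ⇔ₛ V = (U ⊨ₛ V) × (V ⊨ₛ U)

SetoidPred : TPred ℓ → Set (lsuc 0ℓ ⊔ ℓ)
SetoidPred P = ∀ τ τ' → τ ≈ τ' → P τ → P τ'

⟨_⟩Sh : SPred ℓ → Shape → Set ℓ
⟨ U ⟩Sh (nil σ)    = U σ
⟨ U ⟩Sh (cons _ _) = ⊥

⟨_⟩ : SPred ℓ → TPred ℓ
⟨ U ⟩ τ = ⟨ U ⟩Sh (out τ)

-- dup(U) holds exactly of σ :: ⟨σ⟩ with U σ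
dup₂ : ∀ {ℓ} → SPred ℓ → State → Shape → Set ℓ
dup₂ {ℓ} U σ (nil σ')    = Lift ℓ (σ' ≡ σ) × U σ
dup₂ U σ (cons _ _)  = ⊥

dupSh : SPred ℓ → Shape → Set ℓ
dupSh U (nil _)    = ⊥
dupSh U (cons σ τ) = dup₂ U σ (out τ)

dup : SPred ℓ → TPred ℓ
dup U τ = dupSh U (out τ)

followsSh : ∀ {ℓ} → TPred ℓ → (Trace × Trace → Set ℓ) → Shape → Trace → Shape → Set ℓ
followsSh {ℓ} Q R (nil σ)    τ' _             = Lift ℓ (hd τ' ≡ σ) × Q τ'
followsSh {ℓ} Q R (cons σ τ) τ' (cons σ' τ₁') = Lift ℓ (σ ≡ σ') × R (τ , τ₁')
followsSh Q R (cons σ τ) τ' (nil _)       = ⊥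

followsF : TPred ℓ → (Trace × Trace → Set ℓ) → Trace × Trace → Set ℓ
followsF Q R (τ , τ') = followsSh Q R (out τ) τ' (out τ')

follows : TPred ℓ → Trace → Trace → Set (lsuc ℓ)
follows {ℓ} Q τ τ' = ν ℓ (followsF Q) (τ , τ')

infixr 7 _**_
_**_ : TPred a → TPred b → TPred (a ⊔ lsuc b)
(P ** Q) τ' = Σ[ τ ∈ Trace ] (P τ × follows Q τ τ')

daggerF : TPred ℓ → TPred ℓ → TPred (lsuc ℓ)
daggerF P R τ' = ⟨ trueₛ ⟩ τ' ⊎ Σ[ τ ∈ Trace ] (P τ × follows R τ τ')

infix 8 _†
_† : TPred ℓ → TPred (lsuc ℓ)
_† {ℓ} P = ν ℓ (daggerF P)

Last : TPred ℓ → SPred ℓ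
Last P σ = Σ[ τ ∈ Trace ] (P τ × τ ↓ σ)

module Submission where

-- Traces are streams with an end marker and every coinductive notion is a
-- greatest fixed point in Knaster–Tarski form, so no coinduction is available
-- in the metatheory.  The central device is a stepwise characterisation of
-- follows_Q: follows_Q τ τ' holds iff for every n, τ' agrees with τ on the
-- first n steps and, if τ ends within them, continues by a Q-trace.  These
-- n-step approximations are inductive, so the usual facts about follows
-- (monotonicity, composition, splitting a finite follower where its prefix
-- ends, gluing) become structural recursions.  Two constructions need a single
-- coherent follows-proof rather than its approximations: the middle trace for
-- associativity of **, and shrinking a follows_{P†} back to the universe level
-- of P, which the laws for † require.  Invariance of a state predicate under
-- † (law 14) is proved by recursion on the length of the finite trace, using
-- that each iterated step is nonempty.

open import Defs
open import Level using (Level; _⊔_; 0ℓ; Lift; lift; lower) renaming (suc to lsuc)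
open import Data.Nat using (ℕ; zero; suc; _+_; _≤_; _<_; s≤s)
open import Data.Nat.Properties using (≤-trans; ≤-refl; +-monoˡ-≤; m≤n+m)
open import Data.Bool using (Bool; true; false)
open import Data.Product using (_×_; _,_; proj₁; proj₂; Σ-syntax)
open import Data.Sum using (_⊎_; inj₁; inj₂)
open import Data.Unit.Polymorphic using (tt)
open import Data.Empty.Polymorphic using (⊥; ⊥-elim)
open import Relation.Binary.PropositionalEquality
  using (_≡_; _≗_; refl; sym; trans; cong; subst)

private
  variable
    ℓ ℓ' ℓ'' : Level

data ShapeEq : Shape → Shape → Set where
  nil≡  : ∀ {σ} → ShapeEq (nil σ) (nil σ)
  cons≡ : ∀ {σ τ τ'} → τ ≗ τ' → ShapeEq (cons σ τ) (cons σ τ')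

out-≗ : ∀ {τ τ'} → τ ≗ τ' → ShapeEq (out τ) (out τ')
out-≗ {τ} {τ'} e with τ 0 | τ' 0 | e 0
... | σ , true  | .(σ , true)  | refl = nil≡
... | σ , false | .(σ , false) | refl = cons≡ (λ n → e (suc n))

hd-≗ : ∀ {τ τ'} → τ ≗ τ' → hd τ ≡ hd τ'
hd-≗ e = hdSh-eq (out-≗ e)
  where
  hdSh-eq : ∀ {s s'} → ShapeEq s s' → hdSh s ≡ hdSh s'
  hdSh-eq nil≡      = refl
  hdSh-eq (cons≡ _) = refl

≗⇒≈ : ∀ {τ τ'} → τ ≗ τ' → τ ≈ τ'
≗⇒≈ e = Pointwise , post , e
  where
  Pointwise : Trace × Trace → Set
  Pointwise (τ , τ') = τ ≗ τ'
  step : ∀ {s s'} → ShapeEq s s' → ≈Sh Pointwise s s'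
  step nil≡       = refl
  step (cons≡ e') = refl , e'
  post : ∀ p → Pointwise p → ≈F Pointwise p
  post (_ , _) e' = step (out-≗ e')

setoid-≗ : {Q : TPred ℓ} → SetoidPred Q → ∀ {τ τ'} → τ ≗ τ' → Q τ → Q τ'
setoid-≗ Qs e = Qs _ _ (≗⇒≈ e)

length↓ : ∀ {s σ} → s ↓Sh σ → ℕ
length↓ nil↓      = 0
length↓ (cons↓ d) = suc (length↓ d)

⟨⟩-map : {U : SPred ℓ} {V : SPred ℓ'} → U ⊨ₛ V → ⟨ U ⟩ ⊨ ⟨ V ⟩
⟨⟩-map f τ u with out τ | u
... | nil σ | u' = f σ u'

⟨⟩-hd : {U : SPred ℓ} (τ : Trace) → ⟨ U ⟩ τ → U (hd τ)
⟨⟩-hd τ u with out τ | u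
... | nil σ | u' = u'

⟨⟩-∧ : {U : SPred ℓ} {V : SPred ℓ'} (τ : Trace) → U (hd τ) → ⟨ V ⟩ τ → ⟨ U ∧ₛ V ⟩ τ
⟨⟩-∧ τ u v with out τ | u | v
... | nil σ | u' | v' = u' , v'

⟨⟩-last : {U : SPred ℓ} {τ : Trace} {σ : State} → ⟨ U ⟩ τ → τ ↓ σ → U σ × hd τ ≡ σ
⟨⟩-last {τ = τ} u d with out τ | u | d
... | nil σ | u' | nil↓ = u' , refl

⟨false⟩-empty : (τ : Trace) → ⟨ falseₛ ⟩ τ → ⊥ {0ℓ}
⟨false⟩-empty τ f with out τ | f
... | nil σ | ()

dup-hd : {U : SPred ℓ} (τ : Trace) → dup U τ → U (hd τ)
dup-hd {U = U} τ d = dupSh-hd (out τ) d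
  where
  dupSh-hd : ∀ s → dupSh U s → U (hdSh s)
  dupSh-hd (cons σ τ₁) d' with out τ₁ | d'
  ... | nil _ | (_ , u) = u

dup-map : {U : SPred ℓ} {V : SPred ℓ'} → U ⊨ₛ V → dup U ⊨ dup V
dup-map {U = U} {V} f τ d = dupSh-map (out τ) d
  where
  dupSh-map : ∀ s → dupSh U s → dupSh V s
  dupSh-map (cons σ τ₁) d' with out τ₁ | d'
  ... | nil _ | (e , u) = lift (lower e) , f σ u

dup-last : {U : SPred ℓ} {τ : Trace} {σ : State} → dup U τ → τ ↓ σ → U σ
dup-last {U = U} {τ} d dτ with out τ | d | dτ
... | cons σ₀ τ₁ | d' | cons↓ dτ' with out τ₁ | d' | dτ'
...   | nil _ | (lift e , u) | nil↓ = subst U (sym e) u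

dup-length : {U : SPred ℓ} {τ : Trace} {σ : State} → dup U τ → (d : τ ↓ σ) → length↓ d ≡ 1
dup-length {τ = τ} d dτ with out τ | d | dτ
... | cons σ₀ τ₁ | d' | cons↓ dτ' with out τ₁ | d' | dτ'
...   | nil _ | _ | nil↓ = refl

dup-∧ˡ : {U : SPred ℓ} {V : SPred ℓ'} (τ : Trace) → U (hd τ) → dup V τ → dup (U ∧ₛ V) τ
dup-∧ˡ τ u d with out τ | u | d
... | cons σ τ₁ | u' | d' with out τ₁ | d'
...   | nil _ | (e , v) = lift (lower e) , u' , v

dup-∧ʳ : {U : SPred ℓ} {V : SPred ℓ'} (τ : Trace) → dup U τ → (∀ σ → τ ↓ σ → V σ) → dup (U ∧ₛ V) τ
dup-∧ʳ {U = U} {V} τ d ends = combine (out τ) d ends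
  where
  combine₂ : ∀ {σ} s → dup₂ U σ s → (∀ σ' → s ↓Sh σ' → V σ') → dup₂ (U ∧ₛ V) σ s
  combine₂ (nil σ') (lift e , u) ends' = lift e , u , subst V e (ends' σ' nil↓)
  combine : ∀ s → dupSh U s → (∀ σ' → s ↓Sh σ' → V σ') → dupSh (U ∧ₛ V) s
  combine (cons σ τ₁) d' ends' = combine₂ (out τ₁) d' (λ σ' dσ → ends' σ' (cons↓ dσ))

dup-setoid : {U : SPred ℓ} → SetoidPred (dup U)
dup-setoid {U = U} τ τ' (Rel , post , r) d = shift (out τ) (out τ') (post _ r) d
  where
  shift₂ : ∀ {σ} s s' → ≈Sh Rel s s' → dup₂ U σ s → dup₂ U σ s'
  shift₂ (nil _) (nil _) refl d' = d'
  shift : ∀ s s' → ≈Sh Rel s s' → dupSh U s → dupSh U s'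
  shift (cons σ τ₁) (cons .σ τ₁') (refl , r') d' = shift₂ (out τ₁) (out τ₁') (post _ r') d'

infinite-not↓ : {τ : Trace} {σ : State} → infinite τ → τ ↓ σ → ⊥ {0ℓ}
infinite-not↓ {τ} {σ} (Rel , post , r) d = go d (post τ r)
  where
  go : ∀ {s} → s ↓Sh σ → infSh Rel s → ⊥
  go nil↓      ()
  go (cons↓ d') r' = go d' (post _ r')

-- Stepwise characterisation of follows.

-- Approx Q n τ τ': τ' agrees with τ on n steps, and if τ ends within them,
-- τ' goes on from its last state by a Q-trace.
ApproxSh : TPred ℓ → ℕ → Shape → Trace → Shape → Set ℓ
ApproxSh {ℓ} Q n       (nil σ)    τ' s'           = Lift ℓ (hdSh s' ≡ σ) × Q τ'
ApproxSh     Q n       (cons σ τ) τ' (nil _)      = ⊥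
ApproxSh {ℓ} Q zero    (cons σ τ) τ' (cons σ' _)  = Lift ℓ (σ ≡ σ')
ApproxSh {ℓ} Q (suc n) (cons σ τ) τ' (cons σ' τ₁) =
  Lift ℓ (σ ≡ σ') × ApproxSh Q n (out τ) τ₁ (out τ₁)

Approx : TPred ℓ → ℕ → Trace → Trace → Set ℓ
Approx Q n τ τ' = ApproxSh Q n (out τ) τ' (out τ')

Follows : TPred ℓ → Trace → Trace → Set ℓ
Follows Q τ τ' = ∀ n → Approx Q n τ τ'

-- Follows is a post-fixed point of the rule functor of follows, so it is contained in follows.
Follows⇒follows : {Q : TPred ℓ} {τ τ' : Trace} → Follows Q τ τ' → follows Q τ τ'
Follows⇒follows {Q = Q} h = Rel , post , h
  where
  Rel : Trace × Trace → Set _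
  Rel (τ , τ') = Follows Q τ τ'
  step : ∀ s τ' → (∀ n → ApproxSh Q n s τ' (out τ')) → followsSh Q Rel s τ' (out τ')
  step (nil σ) τ' h' = h' 0
  step (cons σ τ) τ' h' with out τ' | h'
  ... | nil _      | h'' = h'' 0
  ... | cons σ' τ₁ | h'' = h'' 0 , λ n → proj₂ (h'' (suc n))
  post : ∀ p → Rel p → followsF Q Rel p
  post (τ , τ') = step (out τ) τ'

-- Conversely, every approximation is obtained by unfolding a post-fixed point n times.
follows⇒Follows : {Q : TPred ℓ} {τ τ' : Trace} → follows Q τ τ' → Follows Q τ τ'
follows⇒Follows {Q = Q} (Rel , post , r) n = unfold n _ _ r
  where
  unfold : ∀ n τ τ' → Rel (τ , τ') → Approx Q n τ τ'
  unfoldSh : ∀ n s τ' → followsSh Q Rel s τ' (out τ') → ApproxSh Q n s τ' (out τ')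
  unfold n τ τ' r' = unfoldSh n (out τ) τ' (post (τ , τ') r')
  unfoldSh n (nil σ) τ' h = h
  unfoldSh n (cons σ τ) τ' h with out τ' | h
  ... | nil _      | ()
  ... | cons σ' τ₁ | (e , r') with n
  ...   | zero  = e
  ...   | suc m = e , unfold m τ τ₁ r'

Follows-mono : {Q : TPred ℓ} {Q' : TPred ℓ'} {τ τ' : Trace}
  → Q ⊨ Q' → Follows Q τ τ' → Follows Q' τ τ'
Follows-mono {Q = Q} {Q'} {τ} {τ'} f h n = mono n (out τ) τ' (out τ') (h n)
  where
  mono : ∀ n s τ₁ s₁ → ApproxSh Q n s τ₁ s₁ → ApproxSh Q' n s τ₁ s₁
  mono n       (nil σ)    τ₁ s₁          (e , q) = lift (lower e) , f τ₁ q
  mono zero    (cons σ τ) τ₁ (cons σ' _) e       = lift (lower e)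
  mono (suc n) (cons σ τ) τ₁ (cons σ' _) (e , h') = lift (lower e) , mono n (out τ) _ _ h'

follows-mono : {Q : TPred ℓ} {Q' : TPred ℓ'} {τ τ' : Trace}
  → Q ⊨ Q' → follows Q τ τ' → follows Q' τ τ'
follows-mono f h = Follows⇒follows (Follows-mono f (follows⇒Follows h))

Follows-hd : {Q : TPred ℓ} {τ τ' : Trace} → Follows Q τ τ' → hd τ' ≡ hd τ
Follows-hd {Q = Q} {τ} {τ'} h = start (out τ) (out τ') (h 0)
  where
  start : ∀ s s' → ApproxSh Q 0 s τ' s' → hdSh s' ≡ hdSh s
  start (nil σ)    s'          (e , _) = lower e
  start (cons σ _) (cons σ' _) e       = sym (lower e)

Approx-≗ : {Q : TPred ℓ} → ∀ n {τ₁ τ₂ τ'} → τ₁ ≗ τ₂ → Approx Q n τ₁ τ' → Approx Q n τ₂ τ'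
Approx-≗ {Q = Q} n {τ' = τ'} e = transport n (out-≗ e) (out τ')
  where
  transport : ∀ n {s₁ s₂} → ShapeEq s₁ s₂ → ∀ s' → ApproxSh Q n s₁ τ' s' → ApproxSh Q n s₂ τ' s'
  transport n       nil≡       s'         h        = h
  transport zero    (cons≡ e') (cons _ _) h        = h
  transport (suc n) (cons≡ e') (cons _ _) (σ≡ , h) = σ≡ , Approx-≗ n e' h

Follows-⟨⟩ᵗ : {Q : TPred ℓ} {σ : State} (τ' : Trace) → hd τ' ≡ σ → Q τ' → Follows Q ⟨ σ ⟩ᵗ τ'
Follows-⟨⟩ᵗ τ' e q n = lift e , q

Follows-refl : (S : SPred ℓ) {τ : Trace} → (∀ σ → τ ↓ σ → S σ) → Follows ⟨ S ⟩ τ τ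
Follows-refl S {τ} ends n = refl-sh n (out τ) ends τ refl
  where
  refl-sh : ∀ n s → (∀ σ → s ↓Sh σ → S σ) → ∀ τ₁ → out τ₁ ≡ s → ApproxSh ⟨ S ⟩ n s τ₁ (out τ₁)
  refl-sh n (nil σ) ends' τ₁ eq =
    subst (λ s → Lift _ (hdSh s ≡ σ) × ⟨ S ⟩Sh s) (sym eq) (lift refl , ends' σ nil↓)
  refl-sh zero (cons σ τ₂) ends' τ₁ eq =
    subst (ApproxSh ⟨ S ⟩ zero (cons σ τ₂) τ₁) (sym eq) (lift refl)
  refl-sh (suc n) (cons σ τ₂) ends' τ₁ eq =
    subst (ApproxSh ⟨ S ⟩ (suc n) (cons σ τ₂) τ₁) (sym eq)
      (lift refl , refl-sh n (out τ₂) (λ σ' d → ends' σ' (cons↓ d)) τ₂ refl)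

Follows-⟨⟩⇒≈ : {S : SPred ℓ} {τ τ' : Trace} → Follows ⟨ S ⟩ τ τ' → τ ≈ τ'
Follows-⟨⟩⇒≈ h = Rel , post , Follows-mono (⟨⟩-map (λ _ _ → tt)) h
  where
  Rel : Trace × Trace → Set
  Rel (τ , τ') = Follows ⟨ trueₛ ⟩ τ τ'
  step : ∀ s τ' → (∀ n → ApproxSh ⟨ trueₛ ⟩ n s τ' (out τ')) → ≈Sh Rel s (out τ')
  step (nil σ) τ' h' with out τ' | h'
  ... | nil σ'   | h'' = sym (lower (proj₁ (h'' 0)))
  ... | cons _ _ | h'' with proj₂ (h'' 0)
  ...   | ()
  step (cons σ τ) τ' h' with out τ' | h'
  ... | nil _      | h'' with h'' 0
  ...   | ()
  step (cons σ τ) τ' h' | cons σ' τ₁ | h'' = lower (h'' 0) , λ n → proj₂ (h'' (suc n))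
  post : ∀ p → Rel p → ≈F Rel p
  post (τ , τ') = step (out τ) τ'

Via : TPred ℓ → TPred ℓ' → TPred (ℓ ⊔ ℓ')
Via Q R τ'' = Σ[ τ' ∈ Trace ] (Q τ' × Follows R τ' τ'')

Follows-trans : {Q : TPred ℓ} {R : TPred ℓ'} {τ τ' τ'' : Trace}
  → Follows Q τ τ' → Follows R τ' τ'' → Follows (Via Q R) τ τ''
Follows-trans {Q = Q} {R} {τ} {τ'} {τ''} h g n = compose n (out τ) τ' τ'' h g
  where
  compose : ∀ n s τ' τ'' → (∀ n → ApproxSh Q n s τ' (out τ')) → Follows R τ' τ''
    → ApproxSh (Via Q R) n s τ'' (out τ'')
  compose n (nil σ) τ' τ'' h' g' =
    lift (trans (Follows-hd g') (lower (proj₁ (h' 0)))) , τ' , proj₂ (h' 0) , g'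
  compose n (cons σ τ₀) τ' τ'' h' g' with out τ' | h' | g'
  ... | nil _ | h'' | _ with h'' 0
  ...   | ()
  compose n (cons σ τ₀) τ' τ'' h' g' | cons σ' τ₁ | h'' | g'' with out τ'' | g''
  ... | nil _ | g₃ with g₃ 0
  ...   | ()
  compose zero    (cons σ τ₀) τ' τ'' h' g' | cons σ' τ₁ | h'' | g'' | cons σ'' τ₂ | g₃ =
    lift (trans (lower (h'' 0)) (lower (g₃ 0)))
  compose (suc n) (cons σ τ₀) τ' τ'' h' g' | cons σ' τ₁ | h'' | g'' | cons σ'' τ₂ | g₃ =
    lift (trans (lower (h'' 0)) (lower (g₃ 0))) ,
    compose n (out τ₀) τ₁ τ₂ (λ k → proj₂ (h'' (suc k))) (λ k → proj₂ (g₃ (suc k)))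

Follows-split : {Q : TPred ℓ} {τ τ' : Trace} {σ : State} → Follows Q τ τ' → (d : τ' ↓ σ)
  → Σ[ s ∈ State ] Σ[ ρ ∈ Trace ] Σ[ dτ ∈ τ ↓ s ]
      (Q ρ × hd ρ ≡ s × Σ[ dρ ∈ ρ ↓ σ ] (length↓ dτ + length↓ dρ ≡ length↓ d))
Follows-split {Q = Q} {τ} {τ'} {σ} h d = split (out τ) τ' h d
  where
  split : ∀ s τ' → (∀ n → ApproxSh Q n s τ' (out τ')) → (d : out τ' ↓Sh σ)
    → Σ[ s₀ ∈ State ] Σ[ ρ ∈ Trace ] Σ[ dτ ∈ s ↓Sh s₀ ]
        (Q ρ × hd ρ ≡ s₀ × Σ[ dρ ∈ ρ ↓ σ ] (length↓ dτ + length↓ dρ ≡ length↓ d))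
  split (nil s₀) τ' h' d' = s₀ , τ' , nil↓ , proj₂ (h' 0) , lower (proj₁ (h' 0)) , d' , refl
  split (cons σ₀ τ₀) τ' h' d' with out τ' | h' | d'
  ... | nil _ | h'' | _ with h'' 0
  ...   | ()
  split (cons σ₀ τ₀) τ' h' d' | cons σ₁ τ₁ | h'' | cons↓ d''
    with split (out τ₀) τ₁ (λ n → proj₂ (h'' (suc n))) d''
  ... | s₀ , ρ , dτ , q , e , dρ , len = s₀ , ρ , cons↓ dτ , q , e , dρ , cong suc len

glue : ∀ {s} (sρ : Shape) → sρ ↓Sh s → Trace → Trace
glue (nil s)    nil↓      τ = τ
glue (cons σ ρ) (cons↓ d) τ = σ :: glue (out ρ) d τ

Follows-glue : {Q : TPred ℓ} {s : State} {τ : Trace} → hd τ ≡ s → Q τ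
  → ∀ n sρ (d : sρ ↓Sh s) → ApproxSh Q n sρ (glue sρ d τ) (out (glue sρ d τ))
Follows-glue e q n       (nil s)    nil↓      = lift e , q
Follows-glue e q zero    (cons σ ρ) (cons↓ d) = lift refl
Follows-glue e q (suc n) (cons σ ρ) (cons↓ d) = lift refl , Follows-glue e q n (out ρ) d

glue-↓ : ∀ {s τ σ} → τ ↓ σ → ∀ sρ (d : sρ ↓Sh s) → glue sρ d τ ↓ σ
glue-↓ dτ (nil s)    nil↓      = dτ
glue-↓ dτ (cons σ ρ) (cons↓ d) = cons↓ (glue-↓ dτ (out ρ) d)

⟨⟩-chop-intro : {S : SPred ℓ} {Q : TPred ℓ'} (τ : Trace) → S (hd τ) → Q τ → (⟨ S ⟩ ** Q) τ
⟨⟩-chop-intro {Q = Q} τ s q = ⟨ hd τ ⟩ᵗ , s , Follows⇒follows (Follows-⟨⟩ᵗ {Q = Q} τ refl q)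

⟨⟩-Follows-elim : {S : SPred ℓ} {Q : TPred ℓ'} {τ τ' : Trace}
  → ⟨ S ⟩ τ → Follows Q τ τ' → S (hd τ') × Q τ'
⟨⟩-Follows-elim {S = S} {Q} {τ} {τ'} s h with out τ | s | h 0
... | nil σ | s' | (e , q) = subst S (sym (lower e)) s' , q

⟨⟩-chop-elim : {S : SPred ℓ} {Q : TPred ℓ'} (τ : Trace) → (⟨ S ⟩ ** Q) τ → S (hd τ) × Q τ
⟨⟩-chop-elim τ (_ , s , f) = ⟨⟩-Follows-elim s (follows⇒Follows f)

chop-⟨⟩-intro : {P : TPred ℓ} {S : SPred ℓ'} (τ : Trace) → P τ → (∀ σ → τ ↓ σ → S σ) → (P ** ⟨ S ⟩) τ
chop-⟨⟩-intro {S = S} τ p ends = τ , p , Follows⇒follows (Follows-refl S ends)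

chop-⟨⟩-elim : {P : TPred ℓ} {S : SPred ℓ'} → SetoidPred P → P ** ⟨ S ⟩ ⊨ P
chop-⟨⟩-elim Ps τ (τ₀ , p , f) = Ps τ₀ τ (Follows-⟨⟩⇒≈ (follows⇒Follows f)) p

-- Iteration.

dagger-mono : {P : TPred ℓ} {D D' : TPred ℓ} → D ⊨ D' → daggerF P D ⊨ daggerF P D'
dagger-mono f τ (inj₁ t)            = inj₁ t
dagger-mono f τ (inj₂ (τ₀ , p , fo)) = inj₂ (τ₀ , p , follows-mono f fo)

dagger-⟨true⟩ : {P : TPred ℓ} → ⟨ trueₛ ⟩ ⊨ P †
dagger-⟨true⟩ {ℓ} τ t = (λ τ' → Lift ℓ (⟨ trueₛ ⟩ τ')) , (λ _ t' → inj₁ (lower t')) , lift t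

PostFixed : TPred ℓ → TPred ℓ → Set (lsuc ℓ)
PostFixed P D = ∀ τ → D τ → daggerF P D τ

-- follows_{P†} quantifies over relations one level up.  Collecting the
-- post-fixed points met along a single follows-proof gives one post-fixed point
-- W at the level of P with Follows W.
module Shrink {P : TPred ℓ} {τ τ' : Trace} (Rel : Trace × Trace → Set (lsuc ℓ))
  (post : ∀ p → Rel p → followsF (P †) Rel p) (r : Rel (τ , τ')) where

  -- the post-fixed point reached after k steps of the follows-proof (empty if none yet)
  reached : ℕ → (τ₁ τ₁' : Trace) → Rel (τ₁ , τ₁') → Σ[ D ∈ TPred ℓ ] PostFixed P D
  reachedSh : ℕ → (s : Shape) → (τ₁' : Trace) → (s' : Shape) → followsSh (P †) Rel s τ₁' s'
    → Σ[ D ∈ TPred ℓ ] PostFixed P D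
  reached k τ₁ τ₁' r' = reachedSh k (out τ₁) τ₁' (out τ₁') (post _ r')
  reachedSh k       (nil σ)     τ₁' s'           (_ , (D , postD , _)) = D , postD
  reachedSh zero    (cons σ τ₁) τ₁' (cons σ' _)  _        = (λ _ → ⊥) , (λ _ ())
  reachedSh (suc k) (cons σ τ₁) τ₁' (cons σ' τ₂) (_ , r') = reached k τ₁ τ₂ r'

  W : TPred ℓ
  W ρ = Σ[ k ∈ ℕ ] proj₁ (reached k τ τ' r) ρ

  W-post : PostFixed P W
  W-post ρ (k , w) = dagger-mono (λ _ w' → k , w') ρ (proj₂ (reached k τ τ' r) ρ w)

  approx : ∀ n τ₁ τ₁' r' → (∀ k ρ → proj₁ (reached k τ₁ τ₁' r') ρ → W ρ) → Approx W n τ₁ τ₁'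
  approxSh : ∀ n s τ₁' s' (h : followsSh (P †) Rel s τ₁' s') → out τ₁' ≡ s'
    → (∀ k ρ → proj₁ (reachedSh k s τ₁' s' h) ρ → W ρ) → ApproxSh W n s τ₁' s'
  approx n τ₁ τ₁' r' emb = approxSh n (out τ₁) τ₁' (out τ₁') (post _ r') refl emb
  approxSh n (nil σ) τ₁' s' (e , (D , _ , d)) eq emb =
    subst (λ s → Lift _ (hdSh s ≡ σ)) eq (lift (lower e)) , emb 0 τ₁' d
  approxSh zero    (cons σ τ₁) τ₁' (cons σ' _)  (e , r') eq emb = lift (lower e)
  approxSh (suc n) (cons σ τ₁) τ₁' (cons σ' τ₂) (e , r') eq emb =
    lift (lower e) , approx n τ₁ τ₂ r' (λ k → emb (suc k))

  W-Follows : Follows W τ τ'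
  W-Follows n = approx n τ τ' r (λ k ρ w → k , w)

shrink : {P : TPred ℓ} {τ τ' : Trace} → follows (P †) τ τ'
  → Σ[ W ∈ TPred ℓ ] (PostFixed P W × Follows W τ τ')
shrink (Rel , post , r) = W , W-post , W-Follows
  where open Shrink Rel post r

dagger-unfold : {P : TPred ℓ} → P † ⊨ ⟨ trueₛ ⟩ ∨ₜ (P ** P †)
dagger-unfold τ (D , post , d) with post τ d
... | inj₁ t              = inj₁ t
... | inj₂ (τ₀ , p , fo) = inj₂ (τ₀ , p , follows-mono (λ ρ w → D , post , w) fo)

-- Law (5), folding: add the current trace to the shrunk post-fixed point.
dagger-fold : {P : TPred ℓ} → ⟨ trueₛ ⟩ ∨ₜ (P ** P †) ⊨ P †
dagger-fold τ (inj₁ t) = dagger-⟨true⟩ τ t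
dagger-fold {ℓ} {P} τ (inj₂ (τ₀ , p , f)) with shrink f
... | W , W-post , fw = D , post , inj₁ (lift refl)
  where
  D : TPred ℓ
  D ρ = Lift ℓ (ρ ≡ τ) ⊎ W ρ
  post : PostFixed P D
  post ρ (inj₁ (lift refl)) = inj₂ (τ₀ , p , Follows⇒follows (Follows-mono (λ _ → inj₂) fw))
  post ρ (inj₂ w)           = dagger-mono (λ _ → inj₂) ρ (W-post ρ w)

-- Law (6), concatenation: a P†-trace followed by P† is a P†-trace.  The post-fixed point
-- consists of the W-traces and the followers of a trace in the first witness D₁.
dagger-concat : {P : TPred ℓ} → P † ** P † ⊨ P †
dagger-concat {ℓ} {P} τ (τ₀ , (D₁ , post₁ , d₁) , f) with shrink f
... | W , W-post , fw = D , post , inj₁ (τ₀ , d₁ , fw)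
  where
  D : TPred ℓ
  D ρ = (Σ[ ρ₀ ∈ Trace ] (D₁ ρ₀ × Follows W ρ₀ ρ)) ⊎ W ρ
  post : PostFixed P D
  post ρ (inj₁ (ρ₀ , d , g)) with post₁ ρ₀ d
  ... | inj₁ t = dagger-mono (λ _ → inj₂) ρ (W-post ρ (proj₂ (⟨⟩-Follows-elim t g)))
  ... | inj₂ (π , p , fp) =
    inj₂ (π , p , Follows⇒follows (Follows-mono (λ _ → inj₁) (Follows-trans (follows⇒Follows fp) g)))
  post ρ (inj₂ w) = dagger-mono (λ _ → inj₂) ρ (W-post ρ w)

-- Law (6), splitting: prefix the one-state trace ⟨hd τ⟩, itself in P†.
dagger-split : {P : TPred ℓ} → P † ⊨ P † ** P †
dagger-split {P = P} τ d = ⟨ hd τ ⟩ᵗ , dagger-⟨true⟩ _ tt , Follows⇒follows (Follows-⟨⟩ᵗ {Q = P †} τ refl d)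

-- Associativity of chop.

-- From one coherent proof of follows_{Q ** R} π τ, build the middle trace ρ:
-- ρ copies π and, where π ends, continues with the Q-trace chosen there.
module Middle {Q : TPred ℓ} {R : TPred ℓ'} (Qs : SetoidPred Q) {π τ : Trace}
  (Rel : Trace × Trace → Set (ℓ ⊔ lsuc ℓ'))
  (post : ∀ p → Rel p → followsF (Q ** R) Rel p) (r : Rel (π , τ)) where

  middle : ℕ → (π₁ τ₁ : Trace) → Rel (π₁ , τ₁) → State × Bool
  middleSh : ℕ → (s : Shape) → (τ₁ : Trace) → (s' : Shape) → followsSh (Q ** R) Rel s τ₁ s' → State × Bool
  middle n π₁ τ₁ r' = middleSh n (out π₁) τ₁ (out τ₁) (post _ r')
  middleSh n       (nil σ)     τ₁ s'           (_ , (ρ , _ , _)) = ρ n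
  middleSh zero    (cons σ π₁) τ₁ (cons σ' _)  _        = σ , false
  middleSh (suc n) (cons σ π₁) τ₁ (cons σ' τ₂) (_ , r') = middle n π₁ τ₂ r'

  prefix : ∀ n π₁ τ₁ r' ρ → ρ ≗ (λ m → middle m π₁ τ₁ r') → Approx Q n π₁ ρ
  prefixSh : ∀ n s τ₁ s' h ρ → ρ ≗ (λ m → middleSh m s τ₁ s' h) → ApproxSh Q n s ρ (out ρ)
  prefix n π₁ τ₁ r' ρ eq = prefixSh n (out π₁) τ₁ (out τ₁) (post _ r') ρ eq
  prefixSh n (nil σ) τ₁ s' (e , (ρ₀ , q , fr)) ρ eq =
    lift (trans (hd-≗ eq) (trans (sym (Follows-hd (follows⇒Follows fr))) (lower e))) ,
    setoid-≗ Qs (λ m → sym (eq m)) q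
  prefixSh n (cons σ π₁) τ₁ (cons σ' τ₂) (e , r') ρ eq with out ρ | out-≗ eq
  ... | .(cons σ _) | cons≡ eq' with n
  ...   | zero  = lift refl
  ...   | suc m = lift refl , prefix m π₁ τ₂ r' _ eq'

  suffix : ∀ n π₁ τ₁ r' ρ → ρ ≗ (λ m → middle m π₁ τ₁ r') → Approx R n ρ τ₁
  suffixSh : ∀ n s τ₁ s' h ρ → out τ₁ ≡ s' → ρ ≗ (λ m → middleSh m s τ₁ s' h) → ApproxSh R n (out ρ) τ₁ s'
  suffix n π₁ τ₁ r' ρ eq = suffixSh n (out π₁) τ₁ (out τ₁) (post _ r') ρ refl eq
  suffixSh n (nil σ) τ₁ s' (e , (ρ₀ , q , fr)) ρ eqτ eq =
    subst (ApproxSh R n (out ρ) τ₁) eqτ (Approx-≗ n (λ m → sym (eq m)) (follows⇒Follows fr n))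
  suffixSh n (cons σ π₁) τ₁ (cons σ' τ₂) (e , r') ρ eqτ eq with out ρ | out-≗ eq
  ... | .(cons σ _) | cons≡ eq' with n
  ...   | zero  = lift (lower e)
  ...   | suc m = lift (lower e) , suffix m π₁ τ₂ r' _ eq'

  ρ : Trace
  ρ m = middle m π τ r

  ρ-follows-π : Follows Q π ρ
  ρ-follows-π n = prefix n π τ r ρ (λ _ → refl)

  τ-follows-ρ : Follows R ρ τ
  τ-follows-ρ n = suffix n π τ r ρ (λ _ → refl)

-- Law (4): the left-to-right direction is composition of followers.
chop-assocˡ : {P : TPred ℓ} {Q : TPred ℓ'} {R : TPred ℓ''} → (P ** Q) ** R ⊨ P ** (Q ** R)
chop-assocˡ τ (ρ , (π , p , fq) , fr) =
  π , p , Follows⇒follows (Follows-mono (λ _ (ρ' , q , g) → ρ' , q , Follows⇒follows g)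
                             (Follows-trans (follows⇒Follows fq) (follows⇒Follows fr)))

-- Law (4), right to left: pass through the middle trace, which needs Q setoid.
chop-assocʳ : {P : TPred ℓ''} {Q : TPred ℓ} {R : TPred ℓ'} → SetoidPred Q → P ** (Q ** R) ⊨ (P ** Q) ** R
chop-assocʳ Qs τ (π , p , (Rel , post , r)) =
  ρ , (π , p , Follows⇒follows ρ-follows-π) , Follows⇒follows τ-follows-ρ
  where open Middle Qs Rel post r

chop-assoc : {P : TPred ℓ''} {Q : TPred ℓ} {R : TPred ℓ'} → SetoidPred Q → (P ** Q) ** R ⇔ P ** (Q ** R)
chop-assoc Qs = chop-assocˡ , chop-assocʳ Qs

-- Law (7): an infinite trace follows itself under ⟨false⟩, and conversely
-- whatever follows under ⟨false⟩ never reaches an end.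
infinite-chop : infinite ⊨ trueₜ ** ⟨ falseₛ ⟩
infinite-chop τ (Rel , post , r) = τ , tt , Follows⇒follows (λ n → self n τ r)
  where
  self : ∀ n τ₁ → Rel τ₁ → Approx ⟨ falseₛ ⟩ n τ₁ τ₁
  selfSh : ∀ n s τ₁ → out τ₁ ≡ s → infSh Rel s → ApproxSh ⟨ falseₛ ⟩ n s τ₁ (out τ₁)
  self n τ₁ r' = selfSh n (out τ₁) τ₁ refl (post τ₁ r')
  selfSh zero    (cons σ τ₂) τ₁ eq r' =
    subst (ApproxSh ⟨ falseₛ ⟩ zero (cons σ τ₂) τ₁) (sym eq) (lift refl)
  selfSh (suc n) (cons σ τ₂) τ₁ eq r' =
    subst (ApproxSh ⟨ falseₛ ⟩ (suc n) (cons σ τ₂) τ₁) (sym eq) (lift refl , self n τ₂ r')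

chop-infinite : trueₜ ** ⟨ falseₛ ⟩ ⊨ infinite
chop-infinite τ (τ₀ , _ , f) = Rel , post , (τ₀ , follows⇒Follows f)
  where
  Rel : TPred 0ℓ
  Rel τ₁ = Σ[ τ₂ ∈ Trace ] Follows ⟨ falseₛ ⟩ τ₂ τ₁
  step : ∀ {τ₁} s s₁ → (∀ n → ApproxSh ⟨ falseₛ ⟩ n s τ₁ s₁) → infSh Rel s₁
  step {τ₁} (nil σ) s₁ h = ⊥-elim (⟨false⟩-empty τ₁ (proj₂ (h 0)))
  step (cons σ τ₂) (nil _)      h = ⊥-elim (h 0)
  step (cons σ τ₂) (cons σ' τ₃) h = τ₂ , λ n → proj₂ (h (suc n))
  post : ∀ τ₁ → Rel τ₁ → infF Rel τ₁
  post τ₁ (τ₂ , h) = step (out τ₂) (out τ₁) h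

Last-infinite : {P : TPred ℓ} → P ⊨ infinite → Last P ⇔ₛ falseₛ
Last-infinite P⊨inf = (λ σ (τ , p , d) → ⊥-elim (infinite-not↓ (P⊨inf τ p) d)) , (λ σ ())

Last-⟨⟩ : {U : SPred ℓ} → Last ⟨ U ⟩ ⇔ₛ U
Last-⟨⟩ = (λ σ (τ , u , d) → proj₁ (⟨⟩-last u d)) , (λ σ u → ⟨ σ ⟩ᵗ , u , nil↓)

Last-chop : {P : TPred ℓ} {Q : TPred ℓ'} → Last (P ** Q) ⊨ₛ Last Q
Last-chop σ (τ , (τ₀ , p , f) , d) with Follows-split (follows⇒Follows f) d
... | _ , ρ , _ , q , _ , dρ , _ = ρ , q , dρ

Last-chop-⟨⟩ : {P : TPred ℓ} {U : SPred ℓ'} → Last (P ** ⟨ U ⟩) ⊨ₛ U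
Last-chop-⟨⟩ σ l = proj₁ Last-⟨⟩ σ (Last-chop σ l)

-- Law (12): a finite P-trace ending in a state of Last P is glued in front of the Q-part.
Last-Last-chop : {P : TPred ℓ} {Q : TPred ℓ'} → Last (⟨ Last P ⟩ ** Q) ⊨ₛ Last (P ** Q)
Last-Last-chop σ (τ , c , d) with ⟨⟩-chop-elim τ c
... | (ρ , p , dρ) , q =
  glue (out ρ) dρ τ , (ρ , p , Follows⇒follows (λ n → Follows-glue refl q n (out ρ) dρ)) ,
  glue-↓ d (out ρ) dρ

-- Law (12), converse: split the finite chop where its P-part ends.
Last-chop-Last : {P : TPred ℓ} {Q : TPred ℓ'} → Last (P ** Q) ⊨ₛ Last (⟨ Last P ⟩ ** Q)
Last-chop-Last {P = P} σ (τ , (ρ , p , f) , d) with Follows-split (follows⇒Follows f) d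
... | s , τ₁ , dρ , q , e , dτ₁ , _ = τ₁ , ⟨⟩-chop-intro τ₁ (subst (Last P) (sym e) (ρ , p , dρ)) q , dτ₁

-- The nonempty
-- steps make each unfolding of X† strictly shorten the remaining trace.
dagger-invariant : {X : TPred ℓ} {I : SPred ℓ'}
  → (∀ {x s} → X x → x ↓ s → I s)
  → (∀ {x s} → X x → (d : x ↓ s) → 1 ≤ length↓ d)
  → ∀ {τ σ} → (X †) τ → I (hd τ) → τ ↓ σ → I σ
dagger-invariant {X = X} {I} ends-in-I nonempty {σ = σ} x† i d = go (suc (length↓ d)) _ d ≤-refl x† i
  where
  go : ∀ n τ (d : τ ↓ σ) → length↓ d < n → (X †) τ → I (hd τ) → I σ
  go (suc m) τ d (s≤s d≤m) (D , post , dτ) i' with post τ dτ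
  ... | inj₁ t = subst I (proj₂ (⟨⟩-last t d)) i'
  ... | inj₂ (x , xX , f) with Follows-split (follows⇒Follows f) d
  ...   | s , τ₁ , dx , Dτ₁ , e , dτ₁ , len =
    go m τ₁ dτ₁ (≤-trans shorter d≤m) (D , post , Dτ₁) (subst I (sym e) (ends-in-I xX dx))
    where
    shorter : suc (length↓ dτ₁) ≤ length↓ d
    shorter = subst (suc (length↓ dτ₁) ≤_) len (+-monoˡ-≤ (length↓ dτ₁) (nonempty xX dx))

-- The steps of (P ** dup I)† are nonempty and end in I, because of their dup part.
chop-dup-nonempty : {P : TPred ℓ} {I : SPred ℓ'} {x : Trace} {s : State}
  → (P ** dup I) x → (d : x ↓ s) → 1 ≤ length↓ d
chop-dup-nonempty (π , _ , f) d with Follows-split (follows⇒Follows f) d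
... | _ , ρ , dπ , dupρ , _ , dρ , len =
  subst (1 ≤_) (trans (cong (length↓ dπ +_) (sym (dup-length dupρ dρ))) len) (m≤n+m 1 (length↓ dπ))

chop-dup-ends : {P : TPred ℓ} {I : SPred ℓ'} {x : Trace} {s : State}
  → (P ** dup I) x → x ↓ s → I s
chop-dup-ends {x = x} {s} c d with Last-chop s (x , c , d)
... | ρ , dupρ , dρ = dup-last dupρ dρ

Last-invariant : {P : TPred ℓ} {I : SPred ℓ} → Last (⟨ I ⟩ ** (P ** dup I) †) ⊨ₛ I
Last-invariant σ (τ , c , d) with ⟨⟩-chop-elim τ c
... | i , x† = dagger-invariant chop-dup-ends chop-dup-nonempty x† i d

⟨⟩-chop-dup : {U V : SPred ℓ} → ⟨ U ⟩ ** dup V ⇔ dup (U ∧ₛ V)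
⟨⟩-chop-dup =
    (λ τ c → let u , dv = ⟨⟩-chop-elim τ c in dup-∧ˡ τ u dv)
  , (λ τ d → ⟨⟩-chop-intro τ (proj₁ (dup-hd τ d)) (dup-map (λ _ → proj₂) τ d))

dup-chop-⟨⟩ : {U V : SPred ℓ} → dup (U ∧ₛ V) ⇔ dup U ** ⟨ V ⟩
dup-chop-⟨⟩ =
    (λ τ d → chop-⟨⟩-intro τ (dup-map (λ _ → proj₁) τ d) (λ σ dσ → proj₂ (dup-last d dσ)))
  , (λ τ c → dup-∧ʳ τ (chop-⟨⟩-elim dup-setoid τ c) (λ σ dσ → Last-chop-⟨⟩ σ (τ , c , dσ)))

⟨⟩-chop-⟨⟩ : {U : SPred ℓ} {V : SPred ℓ'} → ⟨ U ⟩ ** ⟨ V ⟩ ⇔ ⟨ U ∧ₛ V ⟩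
⟨⟩-chop-⟨⟩ =
    (λ τ c → let u , v = ⟨⟩-chop-elim τ c in ⟨⟩-∧ τ u v)
  , (λ τ uv → ⟨⟩-chop-intro τ (proj₁ (⟨⟩-hd τ uv)) (⟨⟩-map (λ _ → proj₂) τ uv))

chop-unitˡ : {P : TPred ℓ} → ⟨ trueₛ ⟩ ** P ⇔ P
chop-unitˡ = (λ τ c → proj₂ (⟨⟩-chop-elim τ c)) , (λ τ p → ⟨⟩-chop-intro τ tt p)

chop-unitʳ : {P : TPred ℓ} → SetoidPred P → P ⇔ P ** ⟨ trueₛ ⟩
chop-unitʳ Ps = (λ τ p → chop-⟨⟩-intro τ p (λ _ _ → tt)) , chop-⟨⟩-elim Ps

chop-Last : {P : TPred ℓ} → SetoidPred P → P ⇔ P ** ⟨ Last P ⟩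
chop-Last Ps = (λ τ p → chop-⟨⟩-intro τ p (λ σ d → τ , p , d)) , chop-⟨⟩-elim Ps

lemma3p6 : ∀ {ℓ : Level} (U V I : SPred ℓ) (P Q R : TPred ℓ)
    → SetoidPred P → SetoidPred Q → SetoidPred R
    → ((⟨ U ⟩ ** dup V ⇔ dup (U ∧ₛ V)) × (dup (U ∧ₛ V) ⇔ dup U ** ⟨ V ⟩))
    × (⟨ U ⟩ ** ⟨ V ⟩ ⇔ ⟨ U ∧ₛ V ⟩)
    × ((⟨ trueₛ ⟩ ** P ⇔ P) × (P ⇔ P ** ⟨ trueₛ ⟩))
    × ((P ** Q) ** R ⇔ P ** (Q ** R))
    × (P † ⇔ ⟨ trueₛ ⟩ ∨ₜ (P ** P †))
    × (P † ⇔ P † ** P †)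
    × (infinite ⇔ trueₜ ** ⟨ falseₛ ⟩)
    × ((P ⊨ infinite) → (Last P ⇔ₛ falseₛ))
    × (P ⇔ P ** ⟨ Last P ⟩)
    × (Last ⟨ U ⟩ ⇔ₛ U)
    × (Last (P ** Q) ⊨ₛ Last Q)
    × (Last (⟨ Last P ⟩ ** Q) ⇔ₛ Last (P ** Q))
    × (Last (P ** ⟨ U ⟩) ⊨ₛ U)
    × (Last (⟨ I ⟩ ** (P ** dup I) †) ⊨ₛ I)
lemma3p6 U V I P Q R Ps Qs _ =
    (⟨⟩-chop-dup , dup-chop-⟨⟩)
  , ⟨⟩-chop-⟨⟩
  , (chop-unitˡ , chop-unitʳ Ps)
  , chop-assoc Qs
  , (dagger-unfold , dagger-fold)
  , (dagger-split , dagger-concat)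
  , (infinite-chop , chop-infinite)
  , Last-infinite
  , chop-Last Ps
  , Last-⟨⟩
  , Last-chop
  , (Last-Last-chop , Last-chop-Last)
  , Last-chop-⟨⟩
  , Last-invariant
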